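{- Let $\mathbf{k}=\mathbb{F}_q$, $\Gamma=\mathrm{Gal}(\overline{\mathbf{k}}/\mathbf{k})$, and let $(M,N,\Phi)=(M,N,\langle-,-\rangle)$ be an object of $\mathrm{Mor}_\Gamma^{\mathbb{N}}$. The following are equivalent: (1) the pairing $\langle-,-\rangle:M\times N\to\mathbb{Z}$ is non-degenerate; (2) $(M,N,\Phi)$ is pointwise polarizable; (3) $(M,N,\Phi)$ is polarizable.
   Context: $\mathrm{Mor}_\Gamma^{\mathbb{N}}$: objects $(M,N,\Phi)$ with $M,N$ free $\mathbb{Z}$-modules of finite rank with continuous (discrete) $\Gamma$-action and $\Phi:M\to N^\vee=\mathrm{Hom}(N,\mathbb{Z})$ $\Gamma$-equivariant (with $(\gamma f)(n)=f(\gamma^{ -1}n)$), equivalently a $\Gamma$-equivariant bilinear pairing $\langle-,-\rangle:M\times N\to\mathbb{Z}$. Non-degenerate means both induced maps $M\to N^\vee$ and $N\to M^\vee$ are injective. A polarization is a $\Gamma$-equivariant injective map $\lambda:M\to N$ with finite cokernel such that $\langle m,\lambda(m')\rangle=\langle m',\lambda(m)\rangle$ for all $m,m'$ and $\langle m,\lambda(m)\rangle>0$ for $m\ne0$. Pointwise polarizable means admitting a polarization when $\Gamma$ is replaced by some open subgroup $\Gamma'\subset\Gamma$. -}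

module Defs where

open import Data.Nat using (ℕ; zero; suc) renaming (_<_ to _<ℕ_)
open import Data.Fin using (Fin; zero; suc)
open import Data.Integer using (ℤ; 0ℤ; _+_; _*_; _<_)
open import Data.Product using (Σ; ∃; _×_)
open import Relation.Binary.PropositionalEquality using (_≡_)
open import Relation.Nullary using (¬_)

Lat : ℕ → Set
Lat r = Fin r → ℤ

_≈_ : ∀ {r} → Lat r → Lat r → Set
x ≈ y = ∀ i → x i ≡ y i

zeroV : ∀ {r} → Lat r
zeroV _ = 0ℤ

_⊕_ : ∀ {r} → Lat r → Lat r → Lat r
(x ⊕ y) i = x i + y i

Σ[_] : ∀ {n} → (Fin n → ℤ) → ℤ
Σ[_] {zero} f = 0ℤ
Σ[_] {suc n} f = f zero + Σ[ (λ i → f (suc i)) ]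

Mat : ℕ → ℕ → Set
Mat s r = Fin s → Fin r → ℤ

apply : ∀ {s r} → Mat s r → Lat r → Lat s
apply A x i = Σ[ (λ j → A i j * x j) ]

iter : ∀ {r} → Mat r r → ℕ → Lat r → Lat r
iter A zero x = x
iter A (suc k) x = apply A (iter A k x)

-- A free ℤ-module of finite rank with continuous (discrete) action of
-- Γ = Gal(k̄/k) ≅ Ẑ (k = F_q), topologically generated by Frobenius.
-- Such an action is the same as a ℤ-linear endomorphism F (Frobenius)
-- of finite order (continuity = action factors through a finite quotient ℤ/n).
record ΓLattice : Set where
  field
    rank : ℕ
    frob : Mat rank rank
    finiteOrder : ∃ λ n → (0 <ℕ n) × (∀ x → iter frob n x ≈ x)
open ΓLattice public

pair : ∀ {r s} → Mat r s → Lat r → Lat s → ℤ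
pair P x y = Σ[ (λ i → Σ[ (λ j → x i * P i j * y j) ]) ]

-- Objects (M, N, Φ) of Mor_Γ^ℕ: Φ : M → N^∨ Γ-equivariant, i.e. a
-- Γ-invariant pairing ⟨γm, γn⟩ = ⟨m, n⟩ (enough to check on Frobenius).
record MorObj : Set where
  field
    M : ΓLattice
    N : ΓLattice
    Φ : Mat (rank M) (rank N)
    equivariant : ∀ x y → pair Φ (apply (frob M) x) (apply (frob N) y) ≡ pair Φ x y
open MorObj public

⟨_∣_,_⟩ : (O : MorObj) → Lat (rank (M O)) → Lat (rank (N O)) → ℤ
⟨ O ∣ x , y ⟩ = pair (Φ O) x y

NonDegenerate : MorObj → Set
NonDegenerate O =
  (∀ x → (∀ y → ⟨ O ∣ x , y ⟩ ≡ 0ℤ) → x ≈ zeroV) ×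
  (∀ y → (∀ x → ⟨ O ∣ x , y ⟩ ≡ 0ℤ) → y ≈ zeroV)

-- λ : M → N is a polarization for the open subgroup Γ' = kẐ (k ≥ 1),
-- i.e. equivariant for Frobenius^k.  (k = 1 gives Γ itself.)
IsPolarization : (O : MorObj) → ℕ → Mat (rank (N O)) (rank (M O)) → Set
IsPolarization O k L =
  (∀ x → apply L (iter (frob (M O)) k x) ≈ iter (frob (N O)) k (apply L x)) ×
  (∀ x x' → apply L x ≈ apply L x' → x ≈ x') ×
  -- finite cokernel: N = ⋃_{i<c} (n_i + λ(M)) for finitely many n_i
  (∃ λ c → Σ (Fin c → Lat (rank (N O))) λ reps →
     ∀ y → ∃ λ i → ∃ λ x → y ≈ (reps i ⊕ apply L x)) ×
  (∀ m m' → ⟨ O ∣ m , apply L m' ⟩ ≡ ⟨ O ∣ m' , apply L m ⟩) ×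
  (∀ m → ¬ (m ≈ zeroV) → 0ℤ < ⟨ O ∣ m , apply L m ⟩)

Polarizable : MorObj → Set
Polarizable O = ∃ λ L → IsPolarization O 1 L

-- Open subgroups of Ẑ are exactly kẐ with k ≥ 1.
PointwisePolarizable : MorObj → Set
PointwisePolarizable O = ∃ λ k → (0 <ℕ k) × (∃ λ L → IsPolarization O k L)

-- A polarization λ makes m ↦ ⟨m, λm⟩ positive definite, so no m ≠ 0 pairs trivially
-- with N.  If n pairs trivially with M, the finite cokernel of λ gives k ≠ 0 and m with
-- k·n = λ(m); then ⟨m, λm⟩ = k⟨m, n⟩ = 0, so m = 0 and n = 0.  Conversely, for a
-- non-degenerate pairing, averaging the standard inner product of M over the finite
-- orbit of Frobenius gives a Γ-invariant positive definite form B.  Gaussian elimination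
-- over ℤ gives d ≠ 0 and Ψ with Φ∘Ψ = d, and λ := Ψ∘(d·G), G the Gram matrix of B,
-- realises ⟨m, λz⟩ = d²·B(m, z).  It is Γ-equivariant because B and the pairing are,
-- and it has finite cokernel because it is invertible up to a nonzero scalar.
module Submission where

open import Defs
open import Data.Product using (Σ; ∃; _×_; _,_; proj₁; proj₂)
open import Data.Sum as Sum using (_⊎_; inj₁; inj₂)
open import Data.Empty using (⊥-elim)
open import Data.Nat as ℕ using (ℕ; zero; suc)
import Data.Nat.Properties as ℕP
open import Data.Fin using (Fin; zero; suc; toℕ; fromℕ<; finToFun; funToFin)
import Data.Fin.Properties as FP
open import Data.Integer using (ℤ; +_; -[1+_]; +[1+_]; 0ℤ; 1ℤ; -1ℤ; _+_; _*_; -_; _-_; _<_; _≤_; +<+; +≤+)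
import Data.Integer.Properties as ℤP
import Data.Integer.DivMod as ℤD
open import Data.Integer.Tactic.RingSolver using (solve-∀)
open import Algebra.Properties.AbelianGroup ℤP.+-0-abelianGroup using () renaming (∙-cancelʳ to +-cancelʳ)
open import Algebra.Properties.Semiring.Sum ℤP.+-*-semiring using (sum; ∑-distrib-+; ∑-comm; *-distribˡ-sum)
open import Function.Base using (_∘_)
open import Function.Bundles using (_⇔_; mk⇔)
open import Relation.Binary.PropositionalEquality using (_≡_; _≢_; refl; sym; trans; cong; cong₂; subst; module ≡-Reasoning)
open import Relation.Nullary using (¬_; Dec; yes; no)

open ≡-Reasoning

Σ≡sum : ∀ {n} (f : Fin n → ℤ) → Σ[ f ] ≡ sum f
Σ≡sum {zero} f = refl
Σ≡sum {suc n} f = cong (_+_ (f zero)) (Σ≡sum (f ∘ suc))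

Σ-cong : ∀ {n} {f g : Fin n → ℤ} → (∀ i → f i ≡ g i) → Σ[ f ] ≡ Σ[ g ]
Σ-cong {zero} h = refl
Σ-cong {suc n} h = cong₂ _+_ (h zero) (Σ-cong (h ∘ suc))

Σ-+ : ∀ {n} (f g : Fin n → ℤ) → Σ[ (λ i → f i + g i) ] ≡ Σ[ f ] + Σ[ g ]
Σ-+ f g = begin
  Σ[ (λ i → f i + g i) ] ≡⟨ Σ≡sum (λ i → f i + g i) ⟩
  sum (λ i → f i + g i)  ≡⟨ ∑-distrib-+ f g ⟩
  sum f + sum g          ≡⟨ sym (cong₂ _+_ (Σ≡sum f) (Σ≡sum g)) ⟩
  Σ[ f ] + Σ[ g ]        ∎

Σ-*ˡ : ∀ {n} (c : ℤ) (f : Fin n → ℤ) → Σ[ (λ i → c * f i) ] ≡ c * Σ[ f ]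
Σ-*ˡ c f = begin
  Σ[ (λ i → c * f i) ] ≡⟨ Σ≡sum (λ i → c * f i) ⟩
  sum (λ i → c * f i)  ≡⟨ sym (*-distribˡ-sum c f) ⟩
  c * sum f            ≡⟨ cong (c *_) (sym (Σ≡sum f)) ⟩
  c * Σ[ f ]           ∎

Σ-*ʳ : ∀ {n} (c : ℤ) (f : Fin n → ℤ) → Σ[ (λ i → f i * c) ] ≡ Σ[ f ] * c
Σ-*ʳ c f = begin
  Σ[ (λ i → f i * c) ] ≡⟨ Σ-cong (λ i → ℤP.*-comm (f i) c) ⟩
  Σ[ (λ i → c * f i) ] ≡⟨ Σ-*ˡ c f ⟩
  c * Σ[ f ]           ≡⟨ ℤP.*-comm c _ ⟩
  Σ[ f ] * c           ∎

Σ-- : ∀ {n} (f g : Fin n → ℤ) → Σ[ (λ i → f i - g i) ] ≡ Σ[ f ] - Σ[ g ]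
Σ-- f g = begin
  Σ[ (λ i → f i - g i) ]         ≡⟨ Σ-+ f (λ i → - g i) ⟩
  Σ[ f ] + Σ[ (λ i → - g i) ]    ≡⟨ cong (_+_ Σ[ f ]) (Σ-cong (λ i → sym (ℤP.-1*i≡-i (g i)))) ⟩
  Σ[ f ] + Σ[ (λ i → -1ℤ * g i) ] ≡⟨ cong (_+_ Σ[ f ]) (trans (Σ-*ˡ -1ℤ g) (ℤP.-1*i≡-i _)) ⟩
  Σ[ f ] - Σ[ g ]                ∎

Σ-swap : ∀ {m n} (f : Fin m → Fin n → ℤ) →
         Σ[ (λ i → Σ[ (λ j → f i j) ]) ] ≡ Σ[ (λ j → Σ[ (λ i → f i j) ]) ]
Σ-swap f = begin
  Σ[ (λ i → Σ[ f i ]) ]                ≡⟨ trans (Σ-cong (λ i → Σ≡sum (f i))) (Σ≡sum (λ i → sum (f i))) ⟩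
  sum (λ i → sum (f i))                ≡⟨ ∑-comm f ⟩
  sum (λ j → sum (λ i → f i j))        ≡⟨ sym (trans (Σ-cong (λ j → Σ≡sum (λ i → f i j))) (Σ≡sum (λ j → sum (λ i → f i j)))) ⟩
  Σ[ (λ j → Σ[ (λ i → f i j) ]) ]      ∎

infixr 25 _·ᵥ_
infixl 24 _⊖_
infix 30 _ᵀ
infixl 28 _∙_

_·ᵥ_ : ∀ {r} → ℤ → Lat r → Lat r
(c ·ᵥ x) i = c * x i

_⊖_ : ∀ {r} → Lat r → Lat r → Lat r
(x ⊖ y) i = x i - y i

dot : ∀ {r} → Lat r → Lat r → ℤ
dot a b = Σ[ (λ i → a i * b i) ]

δ : ∀ {n} → Fin n → Lat n
δ zero zero = 1ℤ
δ zero (suc _) = 0ℤ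
δ (suc _) zero = 0ℤ
δ (suc k) (suc l) = δ k l

_ᵀ : ∀ {s r} → Mat s r → Mat r s
(A ᵀ) i j = A j i

_∙_ : ∀ {t s r} → Mat t s → Mat s r → Mat t r
(B ∙ C) i l = Σ[ (λ j → B i j * C j l) ]

_⊞_ : ∀ {s r} → Mat s r → Mat s r → Mat s r
(A ⊞ B) i j = A i j + B i j

_·ᴹ_ : ∀ {s r} → ℤ → Mat s r → Mat s r
(c ·ᴹ A) i j = c * A i j

dot-comm : ∀ {r} (a b : Lat r) → dot a b ≡ dot b a
dot-comm a b = Σ-cong (λ i → ℤP.*-comm (a i) (b i))

dot-congʳ : ∀ {r} (a : Lat r) {x y : Lat r} → x ≈ y → dot a x ≡ dot a y
dot-congʳ a h = Σ-cong (λ i → cong (a i *_) (h i))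

dot-congˡ : ∀ {r} {x y : Lat r} (b : Lat r) → x ≈ y → dot x b ≡ dot y b
dot-congˡ b h = Σ-cong (λ i → cong (_* b i) (h i))

dot-zeroʳ : ∀ {r} (a : Lat r) → dot a zeroV ≡ 0ℤ
dot-zeroʳ a = trans (Σ-*ʳ 0ℤ a) (ℤP.*-zeroʳ Σ[ a ])

dot-zeroˡ : ∀ {r} (a : Lat r) → dot zeroV a ≡ 0ℤ
dot-zeroˡ a = trans (dot-comm zeroV a) (dot-zeroʳ a)

dot-scaleʳ : ∀ {r} (a : Lat r) c x → dot a (c ·ᵥ x) ≡ c * dot a x
dot-scaleʳ a c x = trans (Σ-cong (λ i → swap (a i) c (x i))) (Σ-*ˡ c (λ i → a i * x i))
  where
  swap : ∀ (p q u : ℤ) → p * (q * u) ≡ q * (p * u)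
  swap = solve-∀

dot-scaleˡ : ∀ {r} (a : Lat r) c x → dot (c ·ᵥ x) a ≡ c * dot x a
dot-scaleˡ a c x = trans (dot-comm (c ·ᵥ x) a) (trans (dot-scaleʳ a c x) (cong (c *_) (dot-comm a x)))

dot-⊕ʳ : ∀ {r} (a x y : Lat r) → dot a (x ⊕ y) ≡ dot a x + dot a y
dot-⊕ʳ a x y = trans (Σ-cong (λ i → ℤP.*-distribˡ-+ (a i) (x i) (y i))) (Σ-+ (λ i → a i * x i) (λ i → a i * y i))

dot-⊖ʳ : ∀ {r} (a x y : Lat r) → dot a (x ⊖ y) ≡ dot a x - dot a y
dot-⊖ʳ a x y = trans (Σ-cong (λ i → distrib (a i) (x i) (y i))) (Σ-- (λ i → a i * x i) (λ i → a i * y i))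
  where
  distrib : ∀ (p u v : ℤ) → p * (u - v) ≡ p * u - p * v
  distrib = solve-∀

dot-⊖ˡ : ∀ {r} (a x y : Lat r) → dot (x ⊖ y) a ≡ dot x a - dot y a
dot-⊖ˡ a x y = trans (dot-comm (x ⊖ y) a)
  (trans (dot-⊖ʳ a x y) (cong₂ _-_ (dot-comm a x) (dot-comm a y)))

dot-δ : ∀ {n} (k : Fin n) (y : Lat n) → dot (δ k) y ≡ y k
dot-δ {suc n} zero y = begin
  1ℤ * y zero + dot (δ zero ∘ suc) (y ∘ suc) ≡⟨ cong (_+_ (1ℤ * y zero)) (Σ-*ˡ 0ℤ (y ∘ suc)) ⟩
  1ℤ * y zero + 0ℤ                           ≡⟨ ℤP.+-identityʳ _ ⟩
  1ℤ * y zero                                ≡⟨ ℤP.*-identityˡ _ ⟩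
  y zero                                     ∎
dot-δ (suc k) y = trans (ℤP.+-identityˡ _) (dot-δ k (y ∘ suc))

apply-cong : ∀ {s r} (A : Mat s r) {x y : Lat r} → x ≈ y → apply A x ≈ apply A y
apply-cong A h i = dot-congʳ (A i) h

apply-zero : ∀ {s r} (A : Mat s r) → apply A zeroV ≈ zeroV
apply-zero A i = dot-zeroʳ (A i)

apply-scale : ∀ {s r} (A : Mat s r) c x → apply A (c ·ᵥ x) ≈ c ·ᵥ apply A x
apply-scale A c x i = dot-scaleʳ (A i) c x

apply-⊖ : ∀ {s r} (A : Mat s r) x y → apply A (x ⊖ y) ≈ apply A x ⊖ apply A y
apply-⊖ A x y i = dot-⊖ʳ (A i) x y

apply-⊞ : ∀ {s r} (A B : Mat s r) x → apply (A ⊞ B) x ≈ (apply A x ⊕ apply B x)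
apply-⊞ A B x i = trans (Σ-cong (λ j → ℤP.*-distribʳ-+ (x j) (A i j) (B i j))) (Σ-+ (λ j → A i j * x j) (λ j → B i j * x j))

apply-·ᴹ : ∀ {s r} c (A : Mat s r) x → apply (c ·ᴹ A) x ≈ c ·ᵥ apply A x
apply-·ᴹ c A x i = trans (Σ-cong (λ j → ℤP.*-assoc c (A i j) (x j))) (Σ-*ˡ c (λ j → A i j * x j))

apply-δ : ∀ {s r} (A : Mat s r) k → apply A (δ k) ≈ λ i → A i k
apply-δ A k i = trans (dot-comm (A i) (δ k)) (dot-δ k (A i))

apply-∙ : ∀ {t s r} (B : Mat t s) (C : Mat s r) y → apply (B ∙ C) y ≈ apply B (apply C y)
apply-∙ B C y i = begin
  Σ[ (λ l → Σ[ (λ j → B i j * C j l) ] * y l) ]   ≡⟨ Σ-cong (λ l → sym (Σ-*ʳ (y l) (λ j → B i j * C j l))) ⟩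
  Σ[ (λ l → Σ[ (λ j → B i j * C j l * y l) ]) ]   ≡⟨ Σ-swap (λ l j → B i j * C j l * y l) ⟩
  Σ[ (λ j → Σ[ (λ l → B i j * C j l * y l) ]) ]   ≡⟨ Σ-cong (λ j → trans (Σ-cong (λ l → ℤP.*-assoc (B i j) (C j l) (y l))) (Σ-*ˡ (B i j) (λ l → C j l * y l))) ⟩
  Σ[ (λ j → B i j * apply C y j) ]                ∎

dot-transpose : ∀ {t s} (A : Mat t s) x y → dot x (apply A y) ≡ dot (apply (A ᵀ) x) y
dot-transpose A x y = begin
  Σ[ (λ i → x i * Σ[ (λ j → A i j * y j) ]) ]   ≡⟨ Σ-cong (λ i → sym (Σ-*ˡ (x i) (λ j → A i j * y j))) ⟩
  Σ[ (λ i → Σ[ (λ j → x i * (A i j * y j)) ]) ] ≡⟨ Σ-cong (λ i → Σ-cong (λ j → reassoc (x i) (A i j) (y j))) ⟩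
  Σ[ (λ i → Σ[ (λ j → A i j * x i * y j) ]) ]   ≡⟨ Σ-swap (λ i j → A i j * x i * y j) ⟩
  Σ[ (λ j → Σ[ (λ i → A i j * x i * y j) ]) ]   ≡⟨ Σ-cong (λ j → Σ-*ʳ (y j) (λ i → A i j * x i)) ⟩
  dot (apply (A ᵀ) x) y                         ∎
  where
  reassoc : ∀ (p q u : ℤ) → p * (q * u) ≡ q * p * u
  reassoc = solve-∀

dot-ᵀ∙ : ∀ {s r} (A : Mat s r) x y → dot x (apply (A ᵀ ∙ A) y) ≡ dot (apply A x) (apply A y)
dot-ᵀ∙ A x y = trans (dot-congʳ x (apply-∙ (A ᵀ) A y)) (dot-transpose (A ᵀ) x (apply A y))

pair-dot : ∀ {r s} (P : Mat r s) x y → pair P x y ≡ dot x (apply P y)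
pair-dot P x y = Σ-cong (λ i → trans (Σ-cong (λ j → ℤP.*-assoc (x i) (P i j) (y j))) (Σ-*ˡ (x i) (λ j → P i j * y j)))

pair-congʳ : ∀ {r s} (P : Mat r s) x {y y'} → y ≈ y' → pair P x y ≡ pair P x y'
pair-congʳ P x {y} {y'} h =
  trans (pair-dot P x y) (trans (dot-congʳ x (apply-cong P h)) (sym (pair-dot P x y')))

pair-congˡ : ∀ {r s} (P : Mat r s) {x x'} y → x ≈ x' → pair P x y ≡ pair P x' y
pair-congˡ P {x} {x'} y h =
  trans (pair-dot P x y) (trans (dot-congˡ (apply P y) h) (sym (pair-dot P x' y)))

pair-scaleʳ : ∀ {r s} (P : Mat r s) x c y → pair P x (c ·ᵥ y) ≡ c * pair P x y
pair-scaleʳ P x c y = begin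
  pair P x (c ·ᵥ y)        ≡⟨ pair-dot P x (c ·ᵥ y) ⟩
  dot x (apply P (c ·ᵥ y)) ≡⟨ dot-congʳ x (apply-scale P c y) ⟩
  dot x (c ·ᵥ apply P y)   ≡⟨ dot-scaleʳ x c (apply P y) ⟩
  c * dot x (apply P y)    ≡⟨ cong (c *_) (sym (pair-dot P x y)) ⟩
  c * pair P x y           ∎

pair-⊖ʳ : ∀ {r s} (P : Mat r s) x y y' → pair P x (y ⊖ y') ≡ pair P x y - pair P x y'
pair-⊖ʳ P x y y' = begin
  pair P x (y ⊖ y')                         ≡⟨ pair-dot P x (y ⊖ y') ⟩
  dot x (apply P (y ⊖ y'))                  ≡⟨ dot-congʳ x (apply-⊖ P y y') ⟩
  dot x (apply P y ⊖ apply P y')            ≡⟨ dot-⊖ʳ x (apply P y) (apply P y') ⟩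
  dot x (apply P y) - dot x (apply P y')    ≡⟨ sym (cong₂ _-_ (pair-dot P x y) (pair-dot P x y')) ⟩
  pair P x y - pair P x y'                  ∎

isZero? : ∀ {r} (x : Lat r) → Dec (x ≈ zeroV)
isZero? x = FP.all? (λ i → x i ℤP.≟ 0ℤ)

≈-from-⊖ : ∀ {r} {x y : Lat r} → x ⊖ y ≈ zeroV → x ≈ y
≈-from-⊖ h i = ℤP.i-j≡0⇒i≡j _ _ (h i)

*-nonzero : ∀ {a b : ℤ} → a ≢ 0ℤ → b ≢ 0ℤ → a * b ≢ 0ℤ
*-nonzero {a} a≢0 b≢0 eq with ℤP.i*j≡0⇒i≡0∨j≡0 a eq
... | inj₁ a≡0 = a≢0 a≡0
... | inj₂ b≡0 = b≢0 b≡0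

*-cancelˡ-zero : ∀ {a b : ℤ} → a ≢ 0ℤ → a * b ≡ 0ℤ → b ≡ 0ℤ
*-cancelˡ-zero {a} a≢0 eq with ℤP.i*j≡0⇒i≡0∨j≡0 a eq
... | inj₁ a≡0 = ⊥-elim (a≢0 a≡0)
... | inj₂ b≡0 = b≡0

0≤i*i : ∀ i → 0ℤ ≤ i * i
0≤i*i (+ zero) = +≤+ ℕ.z≤n
0≤i*i +[1+ n ] = +≤+ ℕ.z≤n
0≤i*i -[1+ n ] = +≤+ ℕ.z≤n

0<i*i : ∀ {i} → i ≢ 0ℤ → 0ℤ < i * i
0<i*i {+ zero} i≢0 = ⊥-elim (i≢0 refl)
0<i*i {+[1+ n ]} _ = +<+ (ℕ.s≤s ℕ.z≤n)
0<i*i { -[1+ n ]} _ = +<+ (ℕ.s≤s ℕ.z≤n)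

0<*0< : ∀ {a b} → 0ℤ < a → 0ℤ < b → 0ℤ < a * b
0<*0< (+<+ (ℕ.s≤s _)) (+<+ (ℕ.s≤s _)) = +<+ (ℕ.s≤s ℕ.z≤n)

0<⇒≢0 : ∀ {z} → 0ℤ < z → z ≢ 0ℤ
0<⇒≢0 0<z z≡0 = ℤP.<-irrefl (sym z≡0) 0<z

0<⇒+[1+] : ∀ {z} → 0ℤ < z → Σ ℕ λ k → z ≡ +[1+ k ]
0<⇒+[1+] {+[1+ k ]} _ = k , refl
0<⇒+[1+] {+ zero} (+<+ ())

0≤+0≤⇒+≡0 : ∀ {a b} → 0ℤ ≤ a → 0ℤ ≤ b → a + b ≡ 0ℤ → (a ≡ 0ℤ) × (b ≡ 0ℤ)
0≤+0≤⇒+≡0 {+ zero} {+ n} _ _ eq = refl , eq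

0≤dot-self : ∀ {r} (x : Lat r) → 0ℤ ≤ dot x x
0≤dot-self {zero} x = +≤+ ℕ.z≤n
0≤dot-self {suc r} x = ℤP.+-mono-≤ (0≤i*i (x zero)) (0≤dot-self (x ∘ suc))

dot-self≡0 : ∀ {r} (x : Lat r) → dot x x ≡ 0ℤ → x ≈ zeroV
dot-self≡0 {suc r} x eq with 0≤+0≤⇒+≡0 (0≤i*i (x zero)) (0≤dot-self (x ∘ suc)) eq
... | x₀*x₀≡0 , rest≡0 = λ
  { zero → Sum.reduce (ℤP.i*j≡0⇒i≡0∨j≡0 (x zero) x₀*x₀≡0)
  ; (suc i) → dot-self≡0 (x ∘ suc) rest≡0 i
  }

0<dot-self : ∀ {r} (x : Lat r) → ¬ (x ≈ zeroV) → 0ℤ < dot x x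
0<dot-self x x≉0 = ℤP.≤∧≢⇒< (0≤dot-self x) (λ 0≡x·x → x≉0 (dot-self≡0 x (sym 0≡x·x)))

iter-cong : ∀ {r} (A : Mat r r) j {x y : Lat r} → x ≈ y → iter A j x ≈ iter A j y
iter-cong A zero h = h
iter-cong A (suc j) h = apply-cong A (iter-cong A j h)

iter-shift : ∀ {r} (A : Mat r r) j x → iter A j (apply A x) ≈ iter A (suc j) x
iter-shift A zero x i = refl
iter-shift A (suc j) x = apply-cong A (iter-shift A j x)

-- Gaussian elimination over ℤ

Injective : ∀ {s r} → Mat s r → Set
Injective A = ∀ x → apply A x ≈ zeroV → x ≈ zeroV

NonzeroKernelVector : ∀ {s r} → Mat s r → Set
NonzeroKernelVector {r = r} A = Σ (Lat r) λ x → ¬ (x ≈ zeroV) × (apply A x ≈ zeroV)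

record LeftQuasiInverse {s r} (A : Mat s r) : Set where
  field
    scale : ℤ
    scale≢0 : scale ≢ 0ℤ
    matrix : Mat r s
    isLeftQuasiInverse : ∀ x → apply matrix (apply A x) ≈ scale ·ᵥ x

record RightQuasiInverse {s r} (A : Mat s r) : Set where
  field
    scale : ℤ
    scale≢0 : scale ≢ 0ℤ
    matrix : Mat r s
    isRightQuasiInverse : ∀ y → apply A (apply matrix y) ≈ scale ·ᵥ y

-- Clearing the first column with the pivot c = A p 0, using only ℤ-row operations:
-- row k becomes c·(row k) − A k 0·(row p).
module PivotElimination {s r} (A : Mat s (suc r)) (p : Fin s) (c≢0 : A p zero ≢ 0ℤ) where

  c : ℤ
  c = A p zero

  A₁ : Mat s r
  A₁ k j = A k (suc j)

  W : Mat s s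
  W k = c ·ᵥ δ k ⊖ A k zero ·ᵥ δ p

  A' : Mat s r
  A' = W ∙ A₁

  apply-W : ∀ y k → apply W y k ≡ c * y k - A k zero * y p
  apply-W y k = begin
    dot (c ·ᵥ δ k ⊖ A k zero ·ᵥ δ p) y            ≡⟨ dot-⊖ˡ y (c ·ᵥ δ k) (A k zero ·ᵥ δ p) ⟩
    dot (c ·ᵥ δ k) y - dot (A k zero ·ᵥ δ p) y    ≡⟨ cong₂ _-_ (dot-scaleˡ y c (δ k)) (dot-scaleˡ y (A k zero) (δ p)) ⟩
    c * dot (δ k) y - A k zero * dot (δ p) y      ≡⟨ cong₂ (λ u v → c * u - A k zero * v) (dot-δ k y) (dot-δ p y) ⟩
    c * y k - A k zero * y p                      ∎

  W-clears-first-column : ∀ x → apply W (apply A x) ≈ apply A' (x ∘ suc)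
  W-clears-first-column x k = begin
    apply W (apply A x) k                                      ≡⟨ apply-W (apply A x) k ⟩
    c * (A k zero * x zero + apply A₁ (x ∘ suc) k)
      - A k zero * (c * x zero + apply A₁ (x ∘ suc) p)         ≡⟨ cancel c (A k zero) (x zero) _ _ ⟩
    c * apply A₁ (x ∘ suc) k - A k zero * apply A₁ (x ∘ suc) p ≡⟨ sym (apply-W (apply A₁ (x ∘ suc)) k) ⟩
    apply W (apply A₁ (x ∘ suc)) k                             ≡⟨ sym (apply-∙ W A₁ (x ∘ suc) k) ⟩
    apply A' (x ∘ suc) k                                       ∎
    where
    cancel : ∀ (c a x₀ u v : ℤ) → c * (a * x₀ + u) - a * (c * x₀ + v) ≡ c * u - a * v
    cancel = solve-∀

  lift-kernel : NonzeroKernelVector A' → NonzeroKernelVector A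
  lift-kernel (v , v≉0 , A'v≈0) = x , x≉0 , Ax≈0
    where
    x : Lat (suc r)
    x zero = - apply A₁ v p
    x (suc j) = c * v j

    x≉0 : ¬ (x ≈ zeroV)
    x≉0 x≈0 = v≉0 (λ j → *-cancelˡ-zero c≢0 (x≈0 (suc j)))

    Ax≈0 : apply A x ≈ zeroV
    Ax≈0 k = begin
      A k zero * (- apply A₁ v p) + apply A₁ (c ·ᵥ v) k ≡⟨ cong (_+_ (A k zero * (- apply A₁ v p))) (apply-scale A₁ c v k) ⟩
      A k zero * (- apply A₁ v p) + c * apply A₁ v k    ≡⟨ reorder (A k zero) (apply A₁ v p) c (apply A₁ v k) ⟩
      c * apply A₁ v k - A k zero * apply A₁ v p        ≡⟨ sym (apply-W (apply A₁ v) k) ⟩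
      apply W (apply A₁ v) k                            ≡⟨ sym (apply-∙ W A₁ v k) ⟩
      apply A' v k                                      ≡⟨ A'v≈0 k ⟩
      0ℤ                                                ∎
      where
      reorder : ∀ (a u c w : ℤ) → a * (- u) + c * w ≡ c * w - a * u
      reorder = solve-∀

  lift-leftQuasiInverse : LeftQuasiInverse A' → LeftQuasiInverse A
  lift-leftQuasiInverse B' = record
    { scale = d * c ; scale≢0 = *-nonzero d≢0 c≢0 ; matrix = B ; isLeftQuasiInverse = BA≈ }
    where
    open LeftQuasiInverse B' renaming
      (scale to d; scale≢0 to d≢0; matrix to B₁; isLeftQuasiInverse to B₁A'≈)

    C : Mat r s
    C = B₁ ∙ W

    CA≈ : ∀ x → apply C (apply A x) ≈ d ·ᵥ (x ∘ suc)
    CA≈ x j = begin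
      apply C (apply A x) j           ≡⟨ apply-∙ B₁ W (apply A x) j ⟩
      apply B₁ (apply W (apply A x)) j ≡⟨ apply-cong B₁ (W-clears-first-column x) j ⟩
      apply B₁ (apply A' (x ∘ suc)) j  ≡⟨ B₁A'≈ (x ∘ suc) j ⟩
      d * x (suc j)                    ∎

    -- C recovers d·x' from A x; row p of A x then recovers c·d·x₀.
    B : Mat (suc r) s
    B zero = d ·ᵥ δ p ⊖ apply (C ᵀ) (A₁ p)
    B (suc j) = c ·ᵥ C j

    BA≈ : ∀ x → apply B (apply A x) ≈ (d * c) ·ᵥ x
    BA≈ x zero = begin
      dot (d ·ᵥ δ p ⊖ apply (C ᵀ) (A₁ p)) y             ≡⟨ dot-⊖ˡ y (d ·ᵥ δ p) (apply (C ᵀ) (A₁ p)) ⟩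
      dot (d ·ᵥ δ p) y - dot (apply (C ᵀ) (A₁ p)) y     ≡⟨ cong₂ _-_ (trans (dot-scaleˡ y d (δ p)) (cong (d *_) (dot-δ p y)))
                                                                      (sym (dot-transpose C (A₁ p) y)) ⟩
      d * y p - dot (A₁ p) (apply C y)                  ≡⟨ cong (λ u → d * y p - u)
                                                             (trans (dot-congʳ (A₁ p) (CA≈ x)) (dot-scaleʳ (A₁ p) d (x ∘ suc))) ⟩
      d * (c * x zero + dot (A₁ p) (x ∘ suc)) - d * dot (A₁ p) (x ∘ suc) ≡⟨ cancel d c (x zero) _ ⟩
      d * c * x zero                                    ∎
      where
      y : Lat s
      y = apply A x
      cancel : ∀ (d c x₀ u : ℤ) → d * (c * x₀ + u) - d * u ≡ d * c * x₀
      cancel = solve-∀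
    BA≈ x (suc j) = begin
      dot (c ·ᵥ C j) (apply A x) ≡⟨ dot-scaleˡ (apply A x) c (C j) ⟩
      c * apply C (apply A x) j  ≡⟨ cong (c *_) (CA≈ x j) ⟩
      c * (d * x (suc j))        ≡⟨ reorder c d (x (suc j)) ⟩
      d * c * x (suc j)          ∎
      where
      reorder : ∀ (c d u : ℤ) → c * (d * u) ≡ d * c * u
      reorder = solve-∀

kernelOrLeftQuasiInverse : ∀ {s} r (A : Mat s r) → NonzeroKernelVector A ⊎ LeftQuasiInverse A
kernelOrLeftQuasiInverse zero A = inj₂ (record
  { scale = 1ℤ ; scale≢0 = λ () ; matrix = λ () ; isLeftQuasiInverse = λ _ () })
kernelOrLeftQuasiInverse (suc r) A with FP.all? (λ k → A k zero ℤP.≟ 0ℤ)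
... | yes firstColumn≈0 = inj₁ (δ zero , (λ e₀≈0 → 1≢0 (e₀≈0 zero)) , λ k → trans (apply-δ A zero k) (firstColumn≈0 k))
  where
  1≢0 : 1ℤ ≢ 0ℤ
  1≢0 ()
... | no firstColumn≉0 with FP.¬∀⟶∃¬ _ _ (λ k → A k zero ℤP.≟ 0ℤ) firstColumn≉0
...   | p , c≢0 = Sum.map lift-kernel lift-leftQuasiInverse (kernelOrLeftQuasiInverse r A')
  where open PivotElimination A p c≢0

injective⇒leftQuasiInverse : ∀ {s r} (A : Mat s r) → Injective A → LeftQuasiInverse A
injective⇒leftQuasiInverse {r = r} A inj with kernelOrLeftQuasiInverse r A
... | inj₁ (x , x≉0 , Ax≈0) = ⊥-elim (x≉0 (inj x Ax≈0))
... | inj₂ B = B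

injectiveᵀ⇒rightQuasiInverse : ∀ {s r} (A : Mat s r) → Injective (A ᵀ) → RightQuasiInverse A
injectiveᵀ⇒rightQuasiInverse A inj = record
  { scale = d ; scale≢0 = d≢0 ; matrix = K ᵀ ; isRightQuasiInverse = AKᵀ≈ }
  where
  open LeftQuasiInverse (injective⇒leftQuasiInverse (A ᵀ) inj) renaming
    (scale to d; scale≢0 to d≢0; matrix to K; isLeftQuasiInverse to KAᵀ≈)

  AKᵀ≈ : ∀ y → apply A (apply (K ᵀ) y) ≈ d ·ᵥ y
  AKᵀ≈ y k = begin
    apply A (apply (K ᵀ) y) k               ≡⟨ sym (dot-δ k (apply A (apply (K ᵀ) y))) ⟩
    dot (δ k) (apply A (apply (K ᵀ) y))     ≡⟨ dot-transpose A (δ k) (apply (K ᵀ) y) ⟩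
    dot (apply (A ᵀ) (δ k)) (apply (K ᵀ) y) ≡⟨ dot-transpose (K ᵀ) (apply (A ᵀ) (δ k)) y ⟩
    dot (apply K (apply (A ᵀ) (δ k))) y     ≡⟨ dot-congˡ y (KAᵀ≈ (δ k)) ⟩
    dot (d ·ᵥ δ k) y                        ≡⟨ dot-scaleˡ y d (δ k) ⟩
    d * dot (δ k) y                         ≡⟨ cong (d *_) (dot-δ k y) ⟩
    d * y k                                 ∎

FiniteCokernel : ∀ {s r} → Mat s r → Set
FiniteCokernel {s} A =
  ∃ λ c → Σ (Fin c → Lat s) λ reps → ∀ y → ∃ λ i → ∃ λ x → y ≈ (reps i ⊕ apply A x)

-- With E = e², every y is E·q plus a vector with entries in [0, E), and E·q = A (R (e·q)).
quasiSection⇒finiteCokernel : ∀ {s r} (A : Mat s r) (R : Lat s → Lat r) {e} → e ≢ 0ℤ →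
                              (∀ y → apply A (R y) ≈ e ·ᵥ y) → FiniteCokernel A
quasiSection⇒finiteCokernel {s} A R {e} e≢0 AR≈ = E ℕ.^ s , reps , covers
  where
  E-1 : ℕ
  E-1 = proj₁ (0<⇒+[1+] (0<i*i e≢0))
  E : ℕ
  E = suc E-1

  e*e≡E : e * e ≡ + E
  e*e≡E = proj₂ (0<⇒+[1+] (0<i*i e≢0))

  reps : Fin (E ℕ.^ s) → Lat s
  reps t l = + toℕ (finToFun t l)

  covers : ∀ y → ∃ λ t → ∃ λ x → y ≈ (reps t ⊕ apply A x)
  covers y = funToFin residue , R (e ·ᵥ quotient) , y≈
    where
    quotient : Lat s
    quotient l = y l ℤD./ℕ E

    residue : Fin s → Fin E
    residue l = fromℕ< (ℤD.n%ℕd<d (y l) E)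

    y≈ : y ≈ (reps (funToFin residue) ⊕ apply A (R (e ·ᵥ quotient)))
    y≈ l = begin
      y l                                   ≡⟨ ℤD.a≡a%ℕn+[a/ℕn]*n (y l) E ⟩
      + (y l ℤD.%ℕ E) + quotient l * + E    ≡⟨ cong₂ _+_ residue≡ quotient≡ ⟩
      reps (funToFin residue) l + apply A (R (e ·ᵥ quotient)) l ∎
      where
      residue≡ : + (y l ℤD.%ℕ E) ≡ reps (funToFin residue) l
      residue≡ = cong +_ (sym (trans (cong toℕ (FP.finToFun-funToFin residue l)) (FP.toℕ-fromℕ< _)))
      quotient≡ : quotient l * + E ≡ apply A (R (e ·ᵥ quotient)) l
      quotient≡ = sym (begin
        apply A (R (e ·ᵥ quotient)) l ≡⟨ AR≈ (e ·ᵥ quotient) l ⟩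
        e * (e * quotient l)          ≡⟨ sym (ℤP.*-assoc e e (quotient l)) ⟩
        e * e * quotient l            ≡⟨ cong (_* quotient l) e*e≡E ⟩
        + E * quotient l              ≡⟨ ℤP.*-comm (+ E) (quotient l) ⟩
        quotient l * + E              ∎)

-- Pigeonhole on the cosets of 0·y, 1·y, …, c·y.
finiteCokernel⇒torsion : ∀ {s r} (A : Mat s r) → FiniteCokernel A →
                         ∀ y → ∃ λ m → (m ≢ 0ℤ) × ∃ λ u → m ·ᵥ y ≈ apply A u
finiteCokernel⇒torsion {s} {r} A (c , reps , covers) y = fromCollision (FP.pigeonhole (ℕP.n<1+n c) coset)
  where
  multiple : Fin (suc c) → Lat s
  multiple j = (+ toℕ j) ·ᵥ y

  coset : Fin (suc c) → Fin c
  coset j = proj₁ (covers (multiple j))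

  preimage : Fin (suc c) → Lat r
  preimage j = proj₁ (proj₂ (covers (multiple j)))

  decomposition : ∀ j → multiple j ≈ (reps (coset j) ⊕ apply A (preimage j))
  decomposition j = proj₂ (proj₂ (covers (multiple j)))

  fromCollision : (∃ λ i → ∃ λ j → toℕ i ℕ.< toℕ j × coset i ≡ coset j) →
                  ∃ λ m → (m ≢ 0ℤ) × ∃ λ u → m ·ᵥ y ≈ apply A u
  fromCollision (i , j , i<j , same) = + toℕ j - + toℕ i , m≢0 , preimage j ⊖ preimage i , my≈
    where
    m≢0 : + toℕ j - + toℕ i ≢ 0ℤ
    m≢0 m≡0 = ℕP.<-irrefl (sym (ℤP.+-injective (ℤP.i-j≡0⇒i≡j _ _ m≡0))) i<j

    my≈ : (+ toℕ j - + toℕ i) ·ᵥ y ≈ apply A (preimage j ⊖ preimage i)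
    my≈ l = begin
      (+ toℕ j - + toℕ i) * y l                                         ≡⟨ distrib (+ toℕ j) (+ toℕ i) (y l) ⟩
      multiple j l - multiple i l                                       ≡⟨ cong₂ _-_ (decomposition j l) (decomposition i l) ⟩
      (reps (coset j) l + Aj) - (reps (coset i) l + Ai)                 ≡⟨ cong (λ t → (reps (coset j) l + Aj) - (reps t l + Ai)) same ⟩
      (reps (coset j) l + Aj) - (reps (coset j) l + Ai)                 ≡⟨ cancel (reps (coset j) l) Aj Ai ⟩
      Aj - Ai                                                           ≡⟨ sym (apply-⊖ A (preimage j) (preimage i) l) ⟩
      apply A (preimage j ⊖ preimage i) l                               ∎
      where
      Aj : ℤ
      Aj = apply A (preimage j) l
      Ai : ℤ
      Ai = apply A (preimage i) l
      distrib : ∀ (a b u : ℤ) → (a - b) * u ≡ a * u - b * u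
      distrib = solve-∀
      cancel : ∀ (t a b : ℤ) → (t + a) - (t + b) ≡ a - b
      cancel = solve-∀

module PositivePairing {r s} (P : Mat r s) (L : Mat s r)
                       (positive : ∀ m → ¬ (m ≈ zeroV) → 0ℤ < pair P m (apply L m)) where

  isotropic⇒zero : ∀ m → pair P m (apply L m) ≡ 0ℤ → m ≈ zeroV
  isotropic⇒zero m isotropic with isZero? m
  ... | yes m≈0 = m≈0
  ... | no m≉0 = ⊥-elim (0<⇒≢0 (positive m m≉0) isotropic)

  injective : ∀ x x' → apply L x ≈ apply L x' → x ≈ x'
  injective x x' Lx≈Lx' = ≈-from-⊖ (isotropic⇒zero (x ⊖ x') (begin
    pair P (x ⊖ x') (apply L (x ⊖ x')) ≡⟨ pair-congʳ P (x ⊖ x') L[x-x']≈0 ⟩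
    pair P (x ⊖ x') zeroV              ≡⟨ pair-dot P (x ⊖ x') zeroV ⟩
    dot (x ⊖ x') (apply P zeroV)       ≡⟨ dot-congʳ (x ⊖ x') (apply-zero P) ⟩
    dot (x ⊖ x') zeroV                 ≡⟨ dot-zeroʳ (x ⊖ x') ⟩
    0ℤ                                 ∎))
    where
    L[x-x']≈0 : apply L (x ⊖ x') ≈ zeroV
    L[x-x']≈0 l = trans (apply-⊖ L x x' l) (ℤP.i≡j⇒i-j≡0 (Lx≈Lx' l))

pointwisePolarizable⇒nonDegenerate : (O : MorObj) → PointwisePolarizable O → NonDegenerate O
pointwisePolarizable⇒nonDegenerate O (_ , _ , L , _ , _ , finiteCokernel , _ , positive) =
  nondegenerateˡ , nondegenerateʳ
  where
  open PositivePairing (Φ O) L positive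

  nondegenerateˡ : ∀ x → (∀ y → ⟨ O ∣ x , y ⟩ ≡ 0ℤ) → x ≈ zeroV
  nondegenerateˡ x x⊥ = isotropic⇒zero x (x⊥ (apply L x))

  nondegenerateʳ : ∀ y → (∀ x → ⟨ O ∣ x , y ⟩ ≡ 0ℤ) → y ≈ zeroV
  nondegenerateʳ y ⊥y with finiteCokernel⇒torsion L finiteCokernel y
  ... | m , m≢0 , u , my≈Lu = λ l → *-cancelˡ-zero m≢0 (trans (my≈Lu l) (trans (apply-cong L u≈0 l) (apply-zero L l)))
    where
    u≈0 : u ≈ zeroV
    u≈0 = isotropic⇒zero u (begin
      ⟨ O ∣ u , apply L u ⟩ ≡⟨ pair-congʳ (Φ O) u (λ l → sym (my≈Lu l)) ⟩
      ⟨ O ∣ u , m ·ᵥ y ⟩    ≡⟨ pair-scaleʳ (Φ O) u m y ⟩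
      m * ⟨ O ∣ u , y ⟩     ≡⟨ cong (m *_) (⊥y u) ⟩
      m * 0ℤ                ≡⟨ ℤP.*-zeroʳ m ⟩
      0ℤ                    ∎)

-- Averaging the standard inner product over the powers of F

module Averaging {r} (F : Mat r r) where

  power : ℕ → Mat r r
  power zero = δ
  power (suc j) = F ∙ power j

  apply-power : ∀ j x → apply (power j) x ≈ iter F j x
  apply-power zero x i = dot-δ i x
  apply-power (suc j) x i = trans (apply-∙ F (power j) x i) (apply-cong F (apply-power j x) i)

  gram : ℕ → Mat r r
  gram zero _ _ = 0ℤ
  gram (suc j) = gram j ⊞ (power j ᵀ ∙ power j)

  form : ℕ → Lat r → Lat r → ℤ
  form zero a b = 0ℤ
  form (suc j) a b = form j a b + dot (iter F j a) (iter F j b)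

  dot-gram≡form : ∀ j a b → dot a (apply (gram j) b) ≡ form j a b
  dot-gram≡form zero a b =
    trans (dot-congʳ a (λ i → trans (Σ-*ˡ 0ℤ b) (ℤP.*-zeroˡ Σ[ b ]))) (dot-zeroʳ a)
  dot-gram≡form (suc j) a b = begin
    dot a (apply (gram j ⊞ Q) b)                     ≡⟨ dot-congʳ a (apply-⊞ (gram j) Q b) ⟩
    dot a (apply (gram j) b ⊕ apply Q b)             ≡⟨ dot-⊕ʳ a (apply (gram j) b) (apply Q b) ⟩
    dot a (apply (gram j) b) + dot a (apply Q b)     ≡⟨ cong₂ _+_ (dot-gram≡form j a b) (dot-ᵀ∙ (power j) a b) ⟩
    form j a b + dot (apply (power j) a) (apply (power j) b)
                                                     ≡⟨ cong (_+_ (form j a b)) (trans (dot-congˡ (apply (power j) b) (apply-power j a))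
                                                                                       (dot-congʳ (iter F j a) (apply-power j b))) ⟩
    form (suc j) a b                                 ∎
    where
    Q : Mat r r
    Q = power j ᵀ ∙ power j

  form-cong : ∀ j {a a' b b'} → a ≈ a' → b ≈ b' → form j a b ≡ form j a' b'
  form-cong zero _ _ = refl
  form-cong (suc j) {a' = a'} {b} a≈a' b≈b' = cong₂ _+_ (form-cong j a≈a' b≈b')
    (trans (dot-congˡ (iter F j b) (iter-cong F j a≈a')) (dot-congʳ (iter F j a') (iter-cong F j b≈b')))

  form-sym : ∀ j a b → form j a b ≡ form j b a
  form-sym zero a b = refl
  form-sym (suc j) a b = cong₂ _+_ (form-sym j a b) (dot-comm (iter F j a) (iter F j b))

  0≤form : ∀ j a → 0ℤ ≤ form j a a
  0≤form zero a = +≤+ ℕ.z≤n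
  0≤form (suc j) a = ℤP.+-mono-≤ (0≤form j a) (0≤dot-self (iter F j a))

  0<form : ∀ j a → ¬ (a ≈ zeroV) → 0ℤ < form (suc j) a a
  0<form zero a a≉0 = ℤP.+-mono-≤-< (+≤+ ℕ.z≤n) (0<dot-self a a≉0)
  0<form (suc j) a a≉0 = ℤP.+-mono-<-≤ (0<form j a a≉0) (0≤dot-self (iter F (suc j) a))

  form-shift : ∀ j a b →
    form j (apply F a) (apply F b) + dot a b ≡ form j a b + dot (iter F j a) (iter F j b)
  form-shift zero a b = refl
  form-shift (suc j) a b = begin
    (form j (apply F a) (apply F b) + dot (iter F j (apply F a)) (iter F j (apply F b))) + dot a b
      ≡⟨ swap (form j (apply F a) (apply F b)) _ (dot a b) ⟩
    (form j (apply F a) (apply F b) + dot a b) + dot (iter F j (apply F a)) (iter F j (apply F b))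
      ≡⟨ cong₂ _+_ (form-shift j a b)
               (trans (dot-congˡ (iter F j (apply F b)) (iter-shift F j a)) (dot-congʳ (iter F (suc j) a) (iter-shift F j b))) ⟩
    form (suc j) a b + dot (iter F (suc j) a) (iter F (suc j) b) ∎
    where
    swap : ∀ (u v w : ℤ) → (u + v) + w ≡ (u + w) + v
    swap = solve-∀

  form-invariant : ∀ n → (∀ x → iter F n x ≈ x) → ∀ a b → form n (apply F a) (apply F b) ≡ form n a b
  form-invariant n Fⁿ≈id a b = +-cancelʳ (dot a b) _ _ (begin
    form n (apply F a) (apply F b) + dot a b ≡⟨ form-shift n a b ⟩
    form n a b + dot (iter F n a) (iter F n b) ≡⟨ cong (_+_ (form n a b)) (trans (dot-congˡ (iter F n b) (Fⁿ≈id a))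
                                                                                 (dot-congʳ a (Fⁿ≈id b))) ⟩
    form n a b + dot a b                     ∎)

module Polarization (O : MorObj) (nd : NonDegenerate O) where

  private
    r : ℕ
    r = rank (M O)
    s : ℕ
    s = rank (N O)
    F : Mat r r
    F = frob (M O)
    H : Mat s s
    H = frob (N O)
    P : Mat r s
    P = Φ O

  pairing-injectiveʳ : ∀ {y y'} → (∀ m → pair P m y ≡ pair P m y') → y ≈ y'
  pairing-injectiveʳ {y} {y'} h = ≈-from-⊖ (proj₂ nd (y ⊖ y') (λ m → trans (pair-⊖ʳ P m y y') (ℤP.i≡j⇒i-j≡0 (h m))))

  Pᵀ-injective : Injective (P ᵀ)
  Pᵀ-injective x Pᵀx≈0 = proj₁ nd x λ y → begin
    pair P x y               ≡⟨ pair-dot P x y ⟩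
    dot x (apply P y)        ≡⟨ dot-transpose P x y ⟩
    dot (apply (P ᵀ) x) y    ≡⟨ dot-congˡ y Pᵀx≈0 ⟩
    dot zeroV y              ≡⟨ dot-zeroˡ y ⟩
    0ℤ                       ∎

  open RightQuasiInverse (injectiveᵀ⇒rightQuasiInverse P Pᵀ-injective) renaming
    (scale to d; scale≢0 to d≢0; matrix to Ψ; isRightQuasiInverse to PΨ≈)

  ΨP≈ : ∀ y → apply Ψ (apply P y) ≈ d ·ᵥ y
  ΨP≈ y = pairing-injectiveʳ λ m → begin
    pair P m (apply Ψ (apply P y))        ≡⟨ pair-dot P m (apply Ψ (apply P y)) ⟩
    dot m (apply P (apply Ψ (apply P y))) ≡⟨ dot-congʳ m (PΨ≈ (apply P y)) ⟩
    dot m (d ·ᵥ apply P y)                ≡⟨ dot-scaleʳ m d (apply P y) ⟩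
    d * dot m (apply P y)                 ≡⟨ cong (d *_) (sym (pair-dot P m y)) ⟩
    d * pair P m y                        ≡⟨ sym (pair-scaleʳ P m d y) ⟩
    pair P m (d ·ᵥ y)                     ∎

  period : Σ ℕ λ n-1 → ∀ x → iter F (suc n-1) x ≈ x
  period with finiteOrder (M O)
  ... | suc n-1 , _ , Fⁿ≈id = n-1 , Fⁿ≈id

  n-1 : ℕ
  n-1 = proj₁ period

  n : ℕ
  n = suc n-1

  open Averaging F

  G : Mat r r
  G = gram n

  -- Scaling by d makes the constant in pair-L a square, hence positive.
  L : Mat s r
  L = Ψ ∙ (d ·ᴹ G)

  pair-L : ∀ m z → pair P m (apply L z) ≡ d * d * form n m z
  pair-L m z = begin
    pair P m (apply L z)                        ≡⟨ pair-dot P m (apply L z) ⟩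
    dot m (apply P (apply L z))                 ≡⟨ dot-congʳ m PL≈ ⟩
    dot m ((d * d) ·ᵥ apply G z)                ≡⟨ dot-scaleʳ m (d * d) (apply G z) ⟩
    d * d * dot m (apply G z)                   ≡⟨ cong (d * d *_) (dot-gram≡form n m z) ⟩
    d * d * form n m z                          ∎
    where
    PL≈ : apply P (apply L z) ≈ (d * d) ·ᵥ apply G z
    PL≈ i = begin
      apply P (apply L z) i                     ≡⟨ apply-cong P (apply-∙ Ψ (d ·ᴹ G) z) i ⟩
      apply P (apply Ψ (apply (d ·ᴹ G) z)) i    ≡⟨ PΨ≈ (apply (d ·ᴹ G) z) i ⟩
      d * apply (d ·ᴹ G) z i                    ≡⟨ cong (d *_) (apply-·ᴹ d G z i) ⟩
      d * (d * apply G z i)                     ≡⟨ sym (ℤP.*-assoc d d (apply G z i)) ⟩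
      d * d * apply G z i                       ∎

  L-equivariant : ∀ x → apply L (apply F x) ≈ apply H (apply L x)
  L-equivariant x = pairing-injectiveʳ samePairing
    where
    samePairing : ∀ m → pair P m (apply L (apply F x)) ≡ pair P m (apply H (apply L x))
    samePairing m = begin
      pair P m (apply L (apply F x))            ≡⟨ pair-L m (apply F x) ⟩
      d * d * form n m (apply F x)              ≡⟨ cong (d * d *_) (form-cong n (λ i → sym (Fm₀≈m i)) (λ _ → refl)) ⟩
      d * d * form n (apply F m₀) (apply F x)   ≡⟨ cong (d * d *_) (form-invariant n (proj₂ period) m₀ x) ⟩
      d * d * form n m₀ x                       ≡⟨ sym (pair-L m₀ x) ⟩
      pair P m₀ (apply L x)                     ≡⟨ sym (equivariant O m₀ (apply L x)) ⟩
      pair P (apply F m₀) (apply H (apply L x)) ≡⟨ pair-congˡ P (apply H (apply L x)) Fm₀≈m ⟩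
      pair P m (apply H (apply L x))            ∎
      where
      m₀ : Lat r
      m₀ = iter F n-1 m
      Fm₀≈m : apply F m₀ ≈ m
      Fm₀≈m = proj₂ period m

  L-symmetric : ∀ m m' → pair P m (apply L m') ≡ pair P m' (apply L m)
  L-symmetric m m' = trans (pair-L m m') (trans (cong (d * d *_) (form-sym n m m')) (sym (pair-L m' m)))

  L-positive : ∀ m → ¬ (m ≈ zeroV) → 0ℤ < pair P m (apply L m)
  L-positive m m≉0 = subst (0ℤ <_) (sym (pair-L m m)) (0<*0< (0<i*i d≢0) (0<form n-1 m m≉0))

  Gᵀ-injective : Injective (G ᵀ)
  Gᵀ-injective z Gᵀz≈0 with isZero? z
  ... | yes z≈0 = z≈0
  ... | no z≉0 = ⊥-elim (0<⇒≢0 (0<form n-1 z z≉0) (begin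
    form n z z                 ≡⟨ sym (dot-gram≡form n z z) ⟩
    dot z (apply G z)          ≡⟨ dot-transpose G z z ⟩
    dot (apply (G ᵀ) z) z      ≡⟨ dot-congˡ z Gᵀz≈0 ⟩
    dot zeroV z                ≡⟨ dot-zeroˡ z ⟩
    0ℤ                         ∎))

  open RightQuasiInverse (injectiveᵀ⇒rightQuasiInverse G Gᵀ-injective) renaming
    (scale to f; scale≢0 to f≢0; matrix to Ĝ; isRightQuasiInverse to GĜ≈)

  L-quasiSection : ∀ y → apply L (apply Ĝ (apply P y)) ≈ (d * f * d) ·ᵥ y
  L-quasiSection y i = begin
    apply L (apply Ĝ (apply P y)) i                    ≡⟨ apply-∙ Ψ (d ·ᴹ G) (apply Ĝ (apply P y)) i ⟩
    apply Ψ (apply (d ·ᴹ G) (apply Ĝ (apply P y))) i   ≡⟨ apply-cong Ψ dGĜ≈ i ⟩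
    apply Ψ ((d * f) ·ᵥ apply P y) i                   ≡⟨ apply-scale Ψ (d * f) (apply P y) i ⟩
    d * f * apply Ψ (apply P y) i                      ≡⟨ cong (d * f *_) (ΨP≈ y i) ⟩
    d * f * (d * y i)                                  ≡⟨ sym (ℤP.*-assoc (d * f) d (y i)) ⟩
    d * f * d * y i                                    ∎
    where
    dGĜ≈ : apply (d ·ᴹ G) (apply Ĝ (apply P y)) ≈ (d * f) ·ᵥ apply P y
    dGĜ≈ j = begin
      apply (d ·ᴹ G) (apply Ĝ (apply P y)) j ≡⟨ apply-·ᴹ d G (apply Ĝ (apply P y)) j ⟩
      d * apply G (apply Ĝ (apply P y)) j    ≡⟨ cong (d *_) (GĜ≈ (apply P y) j) ⟩
      d * (f * apply P y j)                  ≡⟨ sym (ℤP.*-assoc d f (apply P y j)) ⟩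
      d * f * apply P y j                    ∎

  polarizable : Polarizable O
  polarizable =
    L , L-equivariant , PositivePairing.injective P L L-positive ,
    quasiSection⇒finiteCokernel L (apply Ĝ ∘ apply P) (*-nonzero (*-nonzero d≢0 f≢0) d≢0) L-quasiSection ,
    L-symmetric , L-positive

proposition5p4 : (O : MorObj) →
    (NonDegenerate O ⇔ PointwisePolarizable O) × (PointwisePolarizable O ⇔ Polarizable O)
proposition5p4 O =
  mk⇔ (polarizable⇒pointwise ∘ Polarization.polarizable O) (pointwisePolarizable⇒nonDegenerate O) ,
  mk⇔ (Polarization.polarizable O ∘ pointwisePolarizable⇒nonDegenerate O) polarizable⇒pointwise
  where
  polarizable⇒pointwise : Polarizable O → PointwisePolarizable O
  polarizable⇒pointwise (L , isPolarization) = 1 , ℕ.s≤s ℕ.z≤n , L , isPolarization
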